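{- Let $k\ge 3$ and let $G$ be a $k$-edge-connected graph of order $n\ge 3$. Then for every pair of adjacent bases $B_1,B_2$ of $\operatorname{BG}(M_G)$, there are at least $(n-2)(k-1)$ distinct good cycles for $B_1B_2$.
   Context: Graphs are finite and without loops; parallel edges are allowed. For such a graph $G$, the cycle matroid $M_G$ has ground set $E(G)$, and its bases are the edge sets of the spanning trees of $G$. The basis graph $\operatorname{BG}(M_G)$ has the bases as vertices, two bases $B,B'$ being adjacent if and only if $|B\triangle B'|=2$. For adjacent bases $B_1,B_2$ with $B_1\setminus B_2=\{e\}$, a good cycle for $B_1B_2$ is a sequence of four distinct bases $B_1B_2B_3B_4$ forming a cycle in $\operatorname{BG}(M_G)$ (so that $B_2B_3$, $B_3B_4$ and $B_4B_1$ are edges) such that $e\in B_4$ and $e\notin B_3$. -}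

module Defs where

open import Data.Nat using (ℕ; suc; _<_; _∸_)
open import Data.Fin using (Fin)
open import Data.Fin.Subset using (Subset; _∈_; _∉_; _∪_; _∩_; _─_; ∁; ⁅_⁆; ∣_∣)
open import Data.Product using (_×_; Σ)
open import Data.List using (List; length)
open import Data.List.Membership.Propositional using () renaming (_∈_ to _∈ˡ_)
open import Data.List.Relation.Unary.Unique.Propositional using (Unique)
open import Relation.Binary.PropositionalEquality using (_≡_; _≢_)
open import Relation.Nullary using (¬_)

record Graph (n m : ℕ) : Set where
  field
    end₁ : Fin m → Fin n
    end₂ : Fin m → Fin n
    loopless : ∀ e → end₁ e ≢ end₂ e
open Graph public

module _ {n m : ℕ} (G : Graph n m) where

  data Conn (S : Subset m) : Fin n → Fin n → Set where
    here  : ∀ {u} → Conn S u u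
    fwd   : ∀ {v} e → e ∈ S → Conn S (end₂ G e) v → Conn S (end₁ G e) v
    bwd   : ∀ {v} e → e ∈ S → Conn S (end₁ G e) v → Conn S (end₂ G e) v

  Connected : Subset m → Set
  Connected S = ∀ u v → Conn S u v

  -- (V(G), S) is acyclic: every edge of S is a bridge of (V(G), S),
  -- i.e. its endpoints are not joined in S minus that edge
  Acyclic : Subset m → Set
  Acyclic S = ∀ e → e ∈ S → ¬ Conn (S ─ ⁅ e ⁆) (end₁ G e) (end₂ G e)

  -- S is the edge set of a spanning tree = a basis of the cycle matroid M_G
  IsBasis : Subset m → Set
  IsBasis S = Connected S × Acyclic S

  EdgeConnected : ℕ → Set
  EdgeConnected k = ∀ (X : Subset m) → ∣ X ∣ < k → Connected (∁ X)

  Adjacent : Subset m → Subset m → Set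
  Adjacent B B' = ∣ (B ∪ B') ─ (B ∩ B') ∣ ≡ 2

  -- (B₃ , B₄) completes B₁B₂ to a good cycle B₁B₂B₃B₄, where e is the
  -- element of B₁ ∖ B₂
  GoodCycle : Fin m → Subset m → Subset m → Subset m → Subset m → Set
  GoodCycle e B₁ B₂ B₃ B₄ =
    IsBasis B₃ × IsBasis B₄ ×
    B₁ ≢ B₃ × B₁ ≢ B₄ × B₂ ≢ B₃ × B₂ ≢ B₄ × B₃ ≢ B₄ ×
    Adjacent B₂ B₃ × Adjacent B₃ B₄ × Adjacent B₄ B₁ ×
    e ∈ B₄ × e ∉ B₃

module Submission where

-- Write B₂ = B₁ - e + f and let r, s be the ends of e.  Every vertex w ∉ {r, s} is the end, away
-- from r, of the last edge g ≠ e on the B₁-path from r to w, so distinct vertices give distinct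
-- edges g.  For such a g let X be a side of the cut of B₁ - g.  By k-edge-connectivity at least
-- k - 1 edges y ≠ g cross X, and each makes B₁ - g + y a basis.  If f does not cross X, every such
-- y also makes B₂ - g + y a basis and B₁ B₂ (B₂ - g + y) (B₁ - g + y) is a good cycle.  If f
-- crosses X, the k - 2 edges y ∉ {g, e} crossing a side Z of B₂ - g give the good cycles
-- B₁ B₂ (B₂ - g + y) (B₁ - g + f), and one more edge v ∉ {g, f} crossing X (here k ≥ 3 is used)
-- gives a good cycle ending in B₁ - g + v: through B₂ - g + v if v crosses Z, through B₁ - e + v
-- otherwise.  In all of these the fourth basis is B₁ with g exchanged out, so cycles built for
-- different vertices are distinct, and the n - 2 vertices contribute k - 1 cycles each.

open import Defs
open import Level using (Level; _⊔_)
open import Function using (_∘_)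
open import Data.Nat using (ℕ; zero; suc; _≤_; _*_; _∸_; z≤n; s≤s; _<?_)
open import Data.Nat.Properties
  using (≤-trans; ≤-reflexive; ≤-antisym; suc-injective; +-mono-≤; *-monoˡ-≤; ∸-monoˡ-≤;
         ∸-+-assoc; m≤n+m∸n; n≤1+n; ≮⇒≥)
open import Data.Fin using (Fin; zero; suc; _≟_)
import Data.Fin.Properties as Fin
open import Data.Fin.Subset
  using (Subset; inside; outside; _∈_; _∉_; _⊆_; _∪_; _∩_; _─_; _-_; ∁; ⁅_⁆; ∣_∣; ⊤;
         Nonempty; Empty)
open import Data.Fin.Subset.Properties
  using (_∈?_; nonempty?; Empty-unique; ∣⊥∣≡0; ∣⊤∣≡n; p─⊥≡p; p─q⊆p; x∈p⇒∣p-x∣<∣p∣;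
         x∈⁅x⁆; x∈⁅y⁆⇒x≡y; x∉⁅y⁆⇒x≢y; x∈p∪q⁺; x∈p∪q⁻; x∈p∩q⁺; x∈p∩q⁻;
         x∈p∧x∉q⇒x∈p─q; x∈p∧x≢y⇒x∈p-y; x∈∁p⇒x∉p)
open import Data.Vec using ([]; _∷_; here; there)
open import Data.List using (List; []; _∷_; length; map; _++_; allFin)
open import Data.List.Properties using (length-map; length-++)
open import Data.List.Membership.Propositional using () renaming (_∈_ to _∈ˡ_)
open import Data.List.Membership.Propositional.Properties using (∈-map⁻; ∈-allFin)
import Data.List.Relation.Unary.Any as Any
open import Data.List.Relation.Unary.All as All using (All; []; _∷_)
import Data.List.Relation.Unary.All.Properties as All
open import Data.List.Relation.Unary.Unique.Propositional using (Unique; []; _∷_)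
import Data.List.Relation.Unary.Unique.Propositional.Properties as Unique
open import Data.Product using (Σ; ∃; _×_; _,_; proj₁; proj₂; uncurry)
open import Data.Sum using (_⊎_; inj₁; inj₂; [_,_]′)
open import Data.Empty using (⊥-elim)
open import Relation.Nullary using (¬_; Dec; yes; no; does; contradiction; ¬?)
open import Relation.Nullary.Decidable using (map′; _×-dec_; _⊎-dec_)
open import Relation.Unary using (Pred; Decidable)
open import Relation.Binary.PropositionalEquality
  using (_≡_; _≢_; refl; sym; trans; cong; subst; ≢-sym; module ≡-Reasoning)

private
  variable
    ℓ₀ ℓ ℓ′ : Level
    A B I : Set ℓ₀
    c d n : ℕ

-- Subsets

x∈p─q⇒x∉q : ∀ (p q : Subset n) {x} → x ∈ p ─ q → x ∉ q
x∈p─q⇒x∉q (_ ∷ p) (_ ∷ q) (there x∈p─q) (there x∈q) = x∈p─q⇒x∉q p q x∈p─q x∈q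

x∈p-y⇒x∈p×x≢y : ∀ {p : Subset n} {x y} → x ∈ p - y → x ∈ p × x ≢ y
x∈p-y⇒x∈p×x≢y {p = p} {y = y} x∈p-y =
  p─q⊆p p ⁅ y ⁆ x∈p-y , x∉⁅y⁆⇒x≢y (x∈p─q⇒x∉q p ⁅ y ⁆ x∈p-y)

x∈p∧y∉p⇒x≢y : ∀ {p : Subset n} {x y} → x ∈ p → y ∉ p → x ≢ y
x∈p∧y∉p⇒x≢y x∈p y∉p refl = y∉p x∈p

x∈p∧x∉q⇒p≢q : ∀ {p q : Subset n} {x} → x ∈ p → x ∉ q → p ≢ q
x∈p∧x∉q⇒p≢q {x = x} x∈p x∉q p≡q = x∉q (subst (x ∈_) p≡q x∈p)

∣p∣≤1+∣p-x∣ : ∀ (p : Subset n) x → ∣ p ∣ ≤ suc ∣ p - x ∣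
∣p∣≤1+∣p-x∣ (inside  ∷ p) zero    = s≤s (≤-reflexive (cong ∣_∣ (sym (p─⊥≡p p))))
∣p∣≤1+∣p-x∣ (outside ∷ p) zero    = ≤-trans (≤-reflexive (cong ∣_∣ (sym (p─⊥≡p p)))) (n≤1+n _)
∣p∣≤1+∣p-x∣ (inside  ∷ p) (suc x) = s≤s (∣p∣≤1+∣p-x∣ p x)
∣p∣≤1+∣p-x∣ (outside ∷ p) (suc x) = ∣p∣≤1+∣p-x∣ p x

∣p∣≡1+∣p-x∣ : ∀ {p : Subset n} {x} → x ∈ p → ∣ p ∣ ≡ suc ∣ p - x ∣
∣p∣≡1+∣p-x∣ {p = p} {x} x∈p = ≤-antisym (∣p∣≤1+∣p-x∣ p x) (x∈p⇒∣p-x∣<∣p∣ x∈p)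

c≤∣p∣⇒c∸1≤∣p-x∣ : ∀ (p : Subset n) x → c ≤ ∣ p ∣ → c ∸ 1 ≤ ∣ p - x ∣
c≤∣p∣⇒c∸1≤∣p-x∣ p x c≤∣p∣ = ∸-monoˡ-≤ 1 (≤-trans c≤∣p∣ (∣p∣≤1+∣p-x∣ p x))

Empty⇒∣p∣≡0 : ∀ {p : Subset n} → Empty p → ∣ p ∣ ≡ 0
Empty⇒∣p∣≡0 {n = n} empty = trans (cong ∣_∣ (Empty-unique empty)) (∣⊥∣≡0 n)

∣p∣≡0⇒Empty : ∀ {p : Subset n} → ∣ p ∣ ≡ 0 → Empty p
∣p∣≡0⇒Empty ∣p∣≡0 (x , x∈p) = contradiction (trans (sym ∣p∣≡0) (∣p∣≡1+∣p-x∣ x∈p)) λ ()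

∣p∣≡2⇒pair : ∀ {p : Subset n} {x} → ∣ p ∣ ≡ 2 → x ∈ p →
             ∃ λ y → y ∈ p × y ≢ x × (∀ {z} → z ∈ p → z ≡ x ⊎ z ≡ y)
∣p∣≡2⇒pair {p = p} {x} ∣p∣≡2 x∈p = other (nonempty? (p - x))
  where
  ∣p-x∣≡1 : ∣ p - x ∣ ≡ 1
  ∣p-x∣≡1 = suc-injective (trans (sym (∣p∣≡1+∣p-x∣ x∈p)) ∣p∣≡2)
  other : Dec (Nonempty (p - x)) → ∃ λ y → y ∈ p × y ≢ x × (∀ {z} → z ∈ p → z ≡ x ⊎ z ≡ y)
  other (no empty) = contradiction (trans (sym ∣p-x∣≡1) (Empty⇒∣p∣≡0 empty)) λ ()
  other (yes (y , y∈p-x)) = y , y∈p , y≢x , cover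
    where
    y∈p = proj₁ (x∈p-y⇒x∈p×x≢y y∈p-x)
    y≢x = proj₂ (x∈p-y⇒x∈p×x≢y y∈p-x)
    p-x-y-empty : Empty (p - x - y)
    p-x-y-empty = ∣p∣≡0⇒Empty (suc-injective (trans (sym (∣p∣≡1+∣p-x∣ y∈p-x)) ∣p-x∣≡1))
    cover : ∀ {z} → z ∈ p → z ≡ x ⊎ z ≡ y
    cover {z} z∈p with z ≟ x | z ≟ y
    ... | yes z≡x | _       = inj₁ z≡x
    ... | no _    | yes z≡y = inj₂ z≡y
    ... | no z≢x  | no z≢y  =
      contradiction (z , x∈p∧x≢y⇒x∈p-y (x∈p∧x≢y⇒x∈p-y z∈p z≢x) z≢y) p-x-y-empty

pair⇒∣p∣≡2 : ∀ {p : Subset n} {x y} → x ∈ p → y ∈ p → y ≢ x →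
             (∀ {z} → z ∈ p → z ≡ x ⊎ z ≡ y) → ∣ p ∣ ≡ 2
pair⇒∣p∣≡2 {p = p} {x} {y} x∈p y∈p y≢x cover = begin
  ∣ p ∣                 ≡⟨ ∣p∣≡1+∣p-x∣ x∈p ⟩
  suc ∣ p - x ∣         ≡⟨ cong suc (∣p∣≡1+∣p-x∣ (x∈p∧x≢y⇒x∈p-y y∈p y≢x)) ⟩
  suc (suc ∣ p - x - y ∣) ≡⟨ cong suc (cong suc (Empty⇒∣p∣≡0 p-x-y-empty)) ⟩
  2                     ∎
  where
  open ≡-Reasoning
  p-x-y-empty : Empty (p - x - y)
  p-x-y-empty (z , z∈) with x∈p-y⇒x∈p×x≢y z∈
  ... | z∈p-x , z≢y = [ proj₂ (x∈p-y⇒x∈p×x≢y z∈p-x) , z≢y ]′ (cover (proj₁ (x∈p-y⇒x∈p×x≢y z∈p-x)))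

subsetOf : ∀ {P : Pred (Fin n) ℓ} → Decidable P → Subset n
subsetOf {n = zero}  P? = []
subsetOf {n = suc n} P? = does (P? zero) ∷ subsetOf (P? ∘ suc)

∈-subsetOf⁺ : ∀ {P : Pred (Fin n) ℓ} (P? : Decidable P) {x} → P x → x ∈ subsetOf P?
∈-subsetOf⁺ P? {zero} px with P? zero
... | yes _  = here
... | no ¬px = contradiction px ¬px
∈-subsetOf⁺ P? {suc x} px = there (∈-subsetOf⁺ (P? ∘ suc) px)

∈-subsetOf⁻ : ∀ {P : Pred (Fin n) ℓ} (P? : Decidable P) {x} → x ∈ subsetOf P? → P x
∈-subsetOf⁻ P? {zero} x∈ with P? zero | x∈
... | yes px | _ = px
... | no _   | ()
∈-subsetOf⁻ P? {suc x} (there x∈) = ∈-subsetOf⁻ (P? ∘ suc) x∈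

toList : Subset n → List (Fin n)
toList []            = []
toList (inside  ∷ p) = zero ∷ map suc (toList p)
toList (outside ∷ p) = map suc (toList p)

length-toList : ∀ (p : Subset n) → length (toList p) ≡ ∣ p ∣
length-toList []            = refl
length-toList (inside  ∷ p) = cong suc (trans (length-map suc (toList p)) (length-toList p))
length-toList (outside ∷ p) = trans (length-map suc (toList p)) (length-toList p)

∈-toList⁻ : ∀ {p : Subset n} {x} → x ∈ˡ toList p → x ∈ p
∈-toList⁻ {p = inside  ∷ p} (Any.here refl) = here
∈-toList⁻ {p = inside  ∷ p} (Any.there x∈) with ∈-map⁻ suc x∈
... | _ , y∈ , refl = there (∈-toList⁻ y∈)
∈-toList⁻ {p = outside ∷ p} x∈ with ∈-map⁻ suc x∈
... | _ , y∈ , refl = there (∈-toList⁻ y∈)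

toList-unique : ∀ (p : Subset n) → Unique (toList p)
toList-unique []            = []
toList-unique (inside  ∷ p) =
  All.map⁺ (All.universal (λ _ ()) (toList p)) ∷ Unique.map⁺ Fin.suc-injective (toList-unique p)
toList-unique (outside ∷ p) = Unique.map⁺ Fin.suc-injective (toList-unique p)

-- Exchanging one element

swap : Subset n → Fin n → Fin n → Subset n
swap S x y = (S - x) ∪ ⁅ y ⁆

module _ {S : Subset n} {x y : Fin n} where

  ∈-swap⁺ : ∀ {z} → z ∈ S → z ≢ x → z ∈ swap S x y
  ∈-swap⁺ z∈S z≢x = x∈p∪q⁺ (inj₁ (x∈p∧x≢y⇒x∈p-y z∈S z≢x))

  y∈swap : y ∈ swap S x y
  y∈swap = x∈p∪q⁺ (inj₂ (x∈⁅x⁆ y))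

  ∈-swap⁻ : ∀ {z} → z ∈ swap S x y → z ∈ S × z ≢ x ⊎ z ≡ y
  ∈-swap⁻ z∈ with x∈p∪q⁻ (S - x) ⁅ y ⁆ z∈
  ... | inj₁ z∈S-x = inj₁ (x∈p-y⇒x∈p×x≢y z∈S-x)
  ... | inj₂ z∈⁅y⁆ = inj₂ (x∈⁅y⁆⇒x≡y y z∈⁅y⁆)

  ∉-swap : ∀ {z} → z ∉ S → z ≢ y → z ∉ swap S x y
  ∉-swap z∉S z≢y z∈ with ∈-swap⁻ z∈
  ... | inj₁ (z∈S , _) = z∉S z∈S
  ... | inj₂ z≡y       = z≢y z≡y

  x∉swap : x ≢ y → x ∉ swap S x y
  x∉swap x≢y x∈ with ∈-swap⁻ x∈
  ... | inj₁ (_ , x≢x) = x≢x refl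
  ... | inj₂ x≡y       = x≢y x≡y

  S-x⊆swap : S - x ⊆ swap S x y
  S-x⊆swap z∈ = uncurry ∈-swap⁺ (x∈p-y⇒x∈p×x≢y z∈)

  swap-y⊆S-x : swap S x y - y ⊆ S - x
  swap-y⊆S-x z∈ with x∈p-y⇒x∈p×x≢y z∈
  ... | z∈swap , z≢y with ∈-swap⁻ z∈swap
  ...   | inj₁ (z∈S , z≢x) = x∈p∧x≢y⇒x∈p-y z∈S z≢x
  ...   | inj₂ z≡y         = contradiction z≡y z≢y

swap-injective : ∀ {S : Subset n} {x y y′} → y ∉ S → swap S x y ≡ swap S x y′ → y ≡ y′
swap-injective {y = y} y∉S eq with ∈-swap⁻ (subst (y ∈_) eq y∈swap)
... | inj₁ (y∈S , _) = contradiction y∈S y∉S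
... | inj₂ y≡y′      = y≡y′

_△_ : Subset n → Subset n → Subset n
p △ q = (p ∪ q) ─ (p ∩ q)

∈-△⁺ : ∀ {p q : Subset n} {x} → x ∈ p × x ∉ q ⊎ x ∉ p × x ∈ q → x ∈ p △ q
∈-△⁺ {p = p} {q} (inj₁ (x∈p , x∉q)) =
  x∈p∧x∉q⇒x∈p─q (x∈p∪q⁺ (inj₁ x∈p)) (x∉q ∘ proj₂ ∘ x∈p∩q⁻ p q)
∈-△⁺ {p = p} {q} (inj₂ (x∉p , x∈q)) =
  x∈p∧x∉q⇒x∈p─q (x∈p∪q⁺ (inj₂ x∈q)) (x∉p ∘ proj₁ ∘ x∈p∩q⁻ p q)

∈-△⁻ : ∀ {p q : Subset n} {x} → x ∈ p △ q → x ∈ p × x ∉ q ⊎ x ∉ p × x ∈ q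
∈-△⁻ {p = p} {q} x∈△ with x∈p∪q⁻ p q (p─q⊆p _ _ x∈△)
... | inj₁ x∈p = inj₁ (x∈p , λ x∈q → x∈p─q⇒x∉q _ _ x∈△ (x∈p∩q⁺ (x∈p , x∈q)))
... | inj₂ x∈q = inj₂ ((λ x∈p → x∈p─q⇒x∉q _ _ x∈△ (x∈p∩q⁺ (x∈p , x∈q))) , x∈q)

record Exchange (B B′ : Subset n) (x y : Fin n) : Set where
  field
    x∈B   : x ∈ B
    x∉B′  : x ∉ B′
    y∉B   : y ∉ B
    y∈B′  : y ∈ B′
    keep  : ∀ {z} → z ∈ B  → z ≢ x → z ∈ B′
    keep′ : ∀ {z} → z ∈ B′ → z ≢ y → z ∈ B

Exchange-swap : ∀ {S : Subset n} {x y} → x ∈ S → y ∉ S → Exchange S (swap S x y) x y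
Exchange-swap x∈S y∉S = record
  { x∈B   = x∈S
  ; x∉B′  = x∉swap (x∈p∧y∉p⇒x≢y x∈S y∉S)
  ; y∉B   = y∉S
  ; y∈B′  = y∈swap
  ; keep  = ∈-swap⁺
  ; keep′ = λ z∈ z≢y → [ proj₁ , (λ z≡y → contradiction z≡y z≢y) ]′ (∈-swap⁻ z∈)
  }

Exchange-removed-unique : ∀ {B B′ : Subset n} {x x′ y y′} →
                          Exchange B B′ x y → Exchange B B′ x′ y′ → x ≡ x′
Exchange-removed-unique {x = x} {x′} ex ex′ with x ≟ x′
... | yes x≡x′ = x≡x′
... | no x≢x′  = contradiction (Exchange.keep ex′ (Exchange.x∈B ex) x≢x′) (Exchange.x∉B′ ex)

swap-sameAdded-Exchange : ∀ {S : Subset n} {x g v} → x ∈ S → g ∈ S → g ≢ x → v ∉ S →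
                          Exchange (swap S x v) (swap S g v) g x
swap-sameAdded-Exchange x∈S g∈S g≢x v∉S = record
  { x∈B   = ∈-swap⁺ g∈S g≢x
  ; x∉B′  = x∉swap (x∈p∧y∉p⇒x≢y g∈S v∉S)
  ; y∉B   = x∉swap (x∈p∧y∉p⇒x≢y x∈S v∉S)
  ; y∈B′  = ∈-swap⁺ x∈S (≢-sym g≢x)
  ; keep  = λ w∈ w≢g → [ (λ (w∈S , _) → ∈-swap⁺ w∈S w≢g) , (λ { refl → y∈swap }) ]′ (∈-swap⁻ w∈)
  ; keep′ = λ w∈ w≢x → [ (λ (w∈S , _) → ∈-swap⁺ w∈S w≢x) , (λ { refl → y∈swap }) ]′ (∈-swap⁻ w∈)
  }

module _ {B B′ : Subset n} {x y : Fin n} (ex : Exchange B B′ x y) where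
  open Exchange ex

  Exchange-sym : Exchange B′ B y x
  Exchange-sym = record
    { x∈B = y∈B′ ; x∉B′ = y∉B ; y∉B = x∉B′ ; y∈B′ = x∈B ; keep = keep′ ; keep′ = keep }

  Exchange⇒≢ : B ≢ B′
  Exchange⇒≢ = x∈p∧x∉q⇒p≢q x∈B x∉B′

  Exchange⇒∣B△B′∣≡2 : ∣ B △ B′ ∣ ≡ 2
  Exchange⇒∣B△B′∣≡2 =
    pair⇒∣p∣≡2 (∈-△⁺ (inj₁ (x∈B , x∉B′))) (∈-△⁺ (inj₂ (y∉B , y∈B′))) (x∈p∧y∉p⇒x≢y y∈B′ x∉B′) cover
    where
    cover : ∀ {z} → z ∈ B △ B′ → z ≡ x ⊎ z ≡ y
    cover {z} z∈△ with ∈-△⁻ z∈△ | z ≟ x | z ≟ y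
    ... | _                  | yes z≡x | _       = inj₁ z≡x
    ... | _                  | _       | yes z≡y = inj₂ z≡y
    ... | inj₁ (z∈B , z∉B′) | no z≢x  | no _    = contradiction (keep z∈B z≢x) z∉B′
    ... | inj₂ (z∉B , z∈B′) | no _    | no z≢y  = contradiction (keep′ z∈B′ z≢y) z∉B

  Exchange-swapBoth : ∀ {g z} → g ∈ B → g ≢ x → z ∉ B → z ∉ B′ →
                      Exchange (swap B g z) (swap B′ g z) x y
  Exchange-swapBoth {g} {z} g∈B g≢x z∉B z∉B′ = record
    { x∈B   = ∈-swap⁺ x∈B (≢-sym g≢x)
    ; x∉B′  = ∉-swap x∉B′ (x∈p∧y∉p⇒x≢y x∈B z∉B)
    ; y∉B   = ∉-swap y∉B (x∈p∧y∉p⇒x≢y y∈B′ z∉B′)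
    ; y∈B′  = ∈-swap⁺ y∈B′ (≢-sym (x∈p∧y∉p⇒x≢y g∈B y∉B))
    ; keep  = λ w∈ w≢x → [ (λ (w∈B , w≢g) → ∈-swap⁺ (keep w∈B w≢x) w≢g) , added ]′ (∈-swap⁻ w∈)
    ; keep′ = λ w∈ w≢y → [ (λ (w∈B′ , w≢g) → ∈-swap⁺ (keep′ w∈B′ w≢y) w≢g) , added ]′ (∈-swap⁻ w∈)
    }
    where
    added : ∀ {S w} → w ≡ z → w ∈ swap S g z
    added refl = y∈swap

  Exchange-swapCross : ∀ {g z} → g ∈ B → g ≢ x → z ∉ B → z ∉ B′ →
                       Exchange (swap B′ g z) (swap B g y) z x
  Exchange-swapCross {g} {z} g∈B g≢x z∉B z∉B′ = record
    { x∈B   = y∈swap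
    ; x∉B′  = ∉-swap z∉B (≢-sym (x∈p∧y∉p⇒x≢y y∈B′ z∉B′))
    ; y∉B   = ∉-swap x∉B′ (x∈p∧y∉p⇒x≢y x∈B z∉B)
    ; y∈B′  = ∈-swap⁺ x∈B (≢-sym g≢x)
    ; keep  = λ w∈ w≢z → [ uncurry from-B′ , (λ w≡z → contradiction w≡z w≢z) ]′ (∈-swap⁻ w∈)
    ; keep′ = λ w∈ w≢x → [ (λ (w∈B , w≢g) → ∈-swap⁺ (keep w∈B w≢x) w≢g) , from-y ]′ (∈-swap⁻ w∈)
    }
    where
    from-B′ : ∀ {w} → w ∈ B′ → w ≢ g → w ∈ swap B g y
    from-B′ {w} w∈B′ w≢g with w ≟ y
    ... | yes refl = y∈swap
    ... | no w≢y   = ∈-swap⁺ (keep′ w∈B′ w≢y) w≢g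
    from-y : ∀ {w} → w ≡ y → w ∈ swap B′ g z
    from-y refl = ∈-swap⁺ y∈B′ (≢-sym (x∈p∧y∉p⇒x≢y g∈B y∉B))

  Exchange-sameRemoved : ∀ {z} → z ∉ B → z ∉ B′ → Exchange B′ (swap B x z) y z
  Exchange-sameRemoved z∉B z∉B′ = record
    { x∈B   = y∈B′
    ; x∉B′  = ∉-swap y∉B (x∈p∧y∉p⇒x≢y y∈B′ z∉B′)
    ; y∉B   = z∉B′
    ; y∈B′  = y∈swap
    ; keep  = λ w∈B′ w≢y → ∈-swap⁺ (keep′ w∈B′ w≢y) (x∈p∧y∉p⇒x≢y w∈B′ x∉B′)
    ; keep′ = λ w∈ w≢z → [ uncurry keep , (λ w≡z → contradiction w≡z w≢z) ]′ (∈-swap⁻ w∈)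
    }

-- Counting distinct witnesses

record AtLeast {A : Set ℓ₀} (c : ℕ) (P : Pred A ℓ) : Set (ℓ₀ ⊔ ℓ) where
  constructor atLeast
  field
    elements : List A
    unique   : Unique elements
    valid    : All P elements
    enough   : c ≤ length elements

AtLeast-subset : ∀ (p : Subset n) → c ≤ ∣ p ∣ → AtLeast c (_∈ p)
AtLeast-subset p c≤∣p∣ =
  atLeast (toList p) (toList-unique p) (All.tabulate ∈-toList⁻)
          (≤-trans c≤∣p∣ (≤-reflexive (sym (length-toList p))))

AtLeast-weaken : {P : Pred A ℓ} → c ≤ d → AtLeast d P → AtLeast c P
AtLeast-weaken c≤d (atLeast xs u v d≤) = atLeast xs u v (≤-trans c≤d d≤)

AtLeast-nonempty : {P : Pred A ℓ} → AtLeast (suc c) P → ∃ P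
AtLeast-nonempty (atLeast (x ∷ _) _ (px ∷ _) _) = x , px

Unique-map⁺ : {P : Pred A ℓ} {f : A → B} {xs : List A} →
              (∀ {x y} → P x → P y → f x ≡ f y → x ≡ y) →
              All P xs → Unique xs → Unique (map f xs)
Unique-map⁺ inj []         []         = []
Unique-map⁺ inj (px ∷ pxs) (x∉ ∷ uxs) =
  All.map⁺ (All.zipWith (λ (x≢y , py) fx≡fy → x≢y (inj px py fx≡fy)) (x∉ , pxs))
  ∷ Unique-map⁺ inj pxs uxs

AtLeast-map : {P : Pred A ℓ} {Q : Pred B ℓ′} (f : A → B) →
              (∀ {x} → P x → Q (f x)) → (∀ {x y} → P x → P y → f x ≡ f y → x ≡ y) →
              AtLeast c P → AtLeast c Q
AtLeast-map f P⇒Q inj (atLeast xs u v c≤) =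
  atLeast (map f xs) (Unique-map⁺ inj v u) (All.map⁺ (All.map P⇒Q v))
          (≤-trans c≤ (≤-reflexive (sym (length-map f xs))))

AtLeast-mono : {P : Pred A ℓ} {Q : Pred A ℓ′} → (∀ {x} → P x → Q x) → AtLeast c P → AtLeast c Q
AtLeast-mono P⇒Q = AtLeast-map (λ x → x) P⇒Q (λ _ _ x≡y → x≡y)

AtLeast-∷ : {P : Pred A ℓ} {Q : Pred A ℓ′} {x : A} → P x → ¬ Q x →
            AtLeast c (λ y → P y × Q y) → AtLeast (suc c) P
AtLeast-∷ {Q = Q} px ¬qx (atLeast xs u v c≤) =
  atLeast (_ ∷ xs) (All.map (λ (_ , qy) x≡y → ¬qx (subst Q (sym x≡y) qy)) v ∷ u)
          (px ∷ All.map proj₁ v) (s≤s c≤)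

module _ {Q : Pred I ℓ} {P : I → Pred A ℓ′}
         (P-index-unique : ∀ {i j x} → P i x → P j x → i ≡ j)
         (block : ∀ {i} → Q i → AtLeast c (P i)) where

  private
    blocks : ∀ (is : List I) → Unique is → All Q is →
             AtLeast (length is * c) (λ x → ∃ λ i → i ∈ˡ is × P i x)
    blocks []       []         []         = atLeast [] [] [] z≤n
    blocks (i ∷ is) (i∉is ∷ u) (qi ∷ qis) with block qi | blocks is u qis
    ... | atLeast xs uxs vxs c≤ | atLeast ys uys vys l≤ =
      atLeast (xs ++ ys) (Unique.++⁺ uxs uys disjoint)
              (All.++⁺ (All.map (λ pix → i , Any.here refl , pix) vxs)
                       (All.map (λ (j , j∈ , pjx) → j , Any.there j∈ , pjx) vys))
              (≤-trans (+-mono-≤ c≤ l≤) (≤-reflexive (sym (length-++ xs))))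
      where
      disjoint : ∀ {x} → ¬ (x ∈ˡ xs × x ∈ˡ ys)
      disjoint (x∈xs , x∈ys) with All.lookup vys x∈ys
      ... | j , j∈is , pjx = All.lookup i∉is j∈is (P-index-unique (All.lookup vxs x∈xs) pjx)

  AtLeast-concat : AtLeast d Q → AtLeast (d * c) (λ x → ∃ λ i → P i x)
  AtLeast-concat (atLeast is u v d≤) with blocks is u v
  ... | atLeast xs uxs vxs l≤ =
    atLeast xs uxs (All.map (λ (i , _ , pix) → i , pix) vxs) (≤-trans (*-monoˡ-≤ c d≤) l≤)

-- Walks, cuts and bases

module _ {n m : ℕ} (G : Graph n m) where

  private
    variable
      S S′ : Subset m
      X : Subset n
      u v v′ w a b a′ b′ : Fin n
      g h x y : Fin m

  Conn-trans : Conn G S a b → Conn G S b v → Conn G S a v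
  Conn-trans here          q = q
  Conn-trans (fwd x x∈S p) q = fwd x x∈S (Conn-trans p q)
  Conn-trans (bwd x x∈S p) q = bwd x x∈S (Conn-trans p q)

  Conn-edge : x ∈ S → Conn G S (end₁ G x) (end₂ G x)
  Conn-edge x∈S = fwd _ x∈S here

  Conn-sym : Conn G S a b → Conn G S b a
  Conn-sym here          = here
  Conn-sym (fwd x x∈S p) = Conn-trans (Conn-sym p) (bwd x x∈S here)
  Conn-sym (bwd x x∈S p) = Conn-trans (Conn-sym p) (fwd x x∈S here)

  Conn-mono : S ⊆ S′ → Conn G S a b → Conn G S′ a b
  Conn-mono S⊆S′ here          = here
  Conn-mono S⊆S′ (fwd x x∈S p) = fwd x (S⊆S′ x∈S) (Conn-mono S⊆S′ p)
  Conn-mono S⊆S′ (bwd x x∈S p) = bwd x (S⊆S′ x∈S) (Conn-mono S⊆S′ p)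

  Via : Subset m → Fin m → Fin n → Fin n → Set
  Via S h u v = Conn G S u (end₁ G h) × Conn G S (end₂ G h) v
              ⊎ Conn G S u (end₂ G h) × Conn G S (end₁ G h) v

  Conn-split-cons : Conn G S a b → Conn G S b v ⊎ Via S h b v → Conn G S a v ⊎ Via S h a v
  Conn-split-cons p (inj₁ q)              = inj₁ (Conn-trans p q)
  Conn-split-cons p (inj₂ (inj₁ (q , r))) = inj₂ (inj₁ (Conn-trans p q , r))
  Conn-split-cons p (inj₂ (inj₂ (q , r))) = inj₂ (inj₂ (Conn-trans p q , r))

  Conn-split : ∀ h → Conn G S u v → Conn G (S - h) u v ⊎ Via (S - h) h u v
  Conn-split h here = inj₁ here
  Conn-split h (fwd x x∈S p) with x ≟ h | Conn-split h p
  ... | yes refl | inj₁ q              = inj₂ (inj₁ (here , q))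
  ... | yes refl | inj₂ (inj₁ (_ , q)) = inj₂ (inj₁ (here , q))
  ... | yes refl | inj₂ (inj₂ (_ , q)) = inj₁ q
  ... | no x≢h   | r                   = Conn-split-cons (fwd x (x∈p∧x≢y⇒x∈p-y x∈S x≢h) here) r
  Conn-split h (bwd x x∈S p) with x ≟ h | Conn-split h p
  ... | yes refl | inj₁ q              = inj₂ (inj₂ (here , q))
  ... | yes refl | inj₂ (inj₁ (_ , q)) = inj₁ q
  ... | yes refl | inj₂ (inj₂ (_ , q)) = inj₂ (inj₂ (here , q))
  ... | no x≢h   | r                   = Conn-split-cons (bwd x (x∈p∧x≢y⇒x∈p-y x∈S x≢h) here) r

  Conn-unsplit : h ∈ S → Conn G (S - h) u v ⊎ Via (S - h) h u v → Conn G S u v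
  Conn-unsplit h∈S (inj₁ p) = Conn-mono (p─q⊆p _ _) p
  Conn-unsplit h∈S (inj₂ (inj₁ (p , q))) =
    Conn-trans (Conn-mono (p─q⊆p _ _) p) (fwd _ h∈S (Conn-mono (p─q⊆p _ _) q))
  Conn-unsplit h∈S (inj₂ (inj₂ (p , q))) =
    Conn-trans (Conn-mono (p─q⊆p _ _) p) (bwd _ h∈S (Conn-mono (p─q⊆p _ _) q))

  private
    conn?-covered : ∀ (xs : List (Fin m)) S → (∀ {z} → z ∈ S → z ∈ˡ xs) →
                    ∀ u v → Dec (Conn G S u v)
    conn?-covered [] S cover u v = map′ (λ { refl → here }) no-edges (u ≟ v)
      where
      no-edges : Conn G S u v → u ≡ v
      no-edges here          = refl
      no-edges (fwd _ x∈S _) = contradiction (cover x∈S) λ ()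
      no-edges (bwd _ x∈S _) = contradiction (cover x∈S) λ ()
    conn?-covered (x ∷ xs) S cover u v with x ∈? S
    ... | no x∉S  = conn?-covered xs S (λ z∈S → Any.tail (x∈p∧y∉p⇒x≢y z∈S x∉S) (cover z∈S)) u v
    ... | yes x∈S =
      map′ (Conn-unsplit x∈S) (Conn-split x)
           (conn? u v ⊎-dec (conn? u _ ×-dec conn? _ v ⊎-dec conn? u _ ×-dec conn? _ v))
      where
      conn? : ∀ a b → Dec (Conn G (S - x) a b)
      conn? = conn?-covered xs (S - x) λ z∈ →
        let z∈S , z≢x = x∈p-y⇒x∈p×x≢y z∈ in Any.tail z≢x (cover z∈S)

  conn? : ∀ S u v → Dec (Conn G S u v)
  conn? S = conn?-covered (allFin m) S (λ {z} _ → ∈-allFin z)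

  Apart : Subset n → Fin n → Fin n → Set
  Apart X a b = a ∈ X × b ∉ X ⊎ a ∉ X × b ∈ X

  Apart-sym : Apart X a b → Apart X b a
  Apart-sym (inj₁ (a∈ , b∉)) = inj₂ (b∉ , a∈)
  Apart-sym (inj₂ (a∉ , b∈)) = inj₁ (b∈ , a∉)

  Crosses : Subset n → Fin m → Set
  Crosses X y = Apart X (end₁ G y) (end₂ G y)

  Crosses? : ∀ X → Decidable (Crosses X)
  Crosses? X y =
    (end₁ G y ∈? X ×-dec ¬? (end₂ G y ∈? X)) ⊎-dec (¬? (end₁ G y ∈? X) ×-dec end₂ G y ∈? X)

  Closed : Subset m → Subset n → Set
  Closed S X = ∀ {x} → x ∈ S → ¬ Crosses X x

  Closed⇒∈-resp : Closed S X → Conn G S a b → a ∈ X → b ∈ X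
  Closed⇒∈-resp closed here a∈X = a∈X
  Closed⇒∈-resp {X = X} closed (fwd x x∈S p) a∈X with end₂ G x ∈? X
  ... | yes b∈X = Closed⇒∈-resp closed p b∈X
  ... | no b∉X  = contradiction (inj₁ (a∈X , b∉X)) (closed x∈S)
  Closed⇒∈-resp {X = X} closed (bwd x x∈S p) a∈X with end₁ G x ∈? X
  ... | yes b∈X = Closed⇒∈-resp closed p b∈X
  ... | no b∉X  = contradiction (inj₂ (b∉X , a∈X)) (closed x∈S)

  Apart-resp : Closed S X → Conn G S a a′ → Conn G S b b′ → Apart X a b → Apart X a′ b′
  Apart-resp closed p q (inj₁ (a∈ , b∉)) =
    inj₁ (Closed⇒∈-resp closed p a∈ , λ b′∈ → b∉ (Closed⇒∈-resp closed (Conn-sym q) b′∈))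
  Apart-resp closed p q (inj₂ (a∉ , b∈)) =
    inj₂ ((λ a′∈ → a∉ (Closed⇒∈-resp closed (Conn-sym p) a′∈)) , Closed⇒∈-resp closed q b∈)

  Closed⇒¬Apart : Closed S X → Conn G S a b → ¬ Apart X a b
  Closed⇒¬Apart closed p ap with Apart-resp closed p here ap
  ... | inj₁ (b∈ , b∉) = b∉ b∈
  ... | inj₂ (b∉ , b∈) = b∉ b∈

  Closed-minus⇒∉ : Closed (S - g) X → Crosses X y → y ≢ g → y ∉ S
  Closed-minus⇒∉ closed crosses y≢g y∈S = closed (x∈p∧x≢y⇒x∈p-y y∈S y≢g) crosses

  component : Subset m → Fin n → Subset n
  component S u = subsetOf (conn? S u)

  component-closed : Closed S (component S u)
  component-closed {S} {u} x∈S (inj₁ (a∈ , b∉)) =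
    b∉ (∈-subsetOf⁺ (conn? S u) (Conn-trans (∈-subsetOf⁻ (conn? S u) a∈) (Conn-edge x∈S)))
  component-closed {S} {u} x∈S (inj₂ (a∉ , b∈)) =
    a∉ (∈-subsetOf⁺ (conn? S u)
                    (Conn-trans (∈-subsetOf⁻ (conn? S u) b∈) (Conn-sym (Conn-edge x∈S))))

  cut : Subset n → Subset m
  cut X = subsetOf (Crosses? X)

  ∈-cut-y⁻ : x ∈ cut X - y → Crosses X x × x ≢ y
  ∈-cut-y⁻ {X = X} x∈ = let x∈cut , x≢y = x∈p-y⇒x∈p×x≢y x∈ in ∈-subsetOf⁻ (Crosses? X) x∈cut , x≢y

  k≤∣cut∣ : ∀ {k} → EdgeConnected G k → Apart X a b → k ≤ ∣ cut X ∣
  k≤∣cut∣ {X} {k = k} edge-connected ap with ∣ cut X ∣ <? k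
  ... | no ∣cut∣≮k  = ≮⇒≥ ∣cut∣≮k
  ... | yes ∣cut∣<k = contradiction ap (Closed⇒¬Apart closed (edge-connected (cut X) ∣cut∣<k _ _))
    where
    closed : Closed (∁ (cut X)) X
    closed x∈∁cut crosses = x∈∁p⇒x∉p x∈∁cut (∈-subsetOf⁺ (Crosses? X) crosses)

  cut-edges : ∀ {k} → EdgeConnected G k → Apart X a b → ∀ h → AtLeast (k ∸ 1) (_∈ cut X - h)
  cut-edges {X} edge-connected ap h =
    AtLeast-subset (cut X - h) (c≤∣p∣⇒c∸1≤∣p-x∣ (cut X) h (k≤∣cut∣ edge-connected ap))

  cut-edges₂ : ∀ {k} → EdgeConnected G k → Apart X a b → ∀ h h′ →
               AtLeast (k ∸ 1 ∸ 1) (_∈ cut X - h - h′)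
  cut-edges₂ {X} edge-connected ap h h′ =
    AtLeast-subset (cut X - h - h′)
      (c≤∣p∣⇒c∸1≤∣p-x∣ (cut X - h) h′ (c≤∣p∣⇒c∸1≤∣p-x∣ (cut X) h (k≤∣cut∣ edge-connected ap)))

  Separates : Subset m → Fin m → Fin m → Set
  Separates S g y = ¬ Conn G (S - g) (end₁ G y) (end₂ G y)

  Closed⇒Separates : Closed (S - g) X → Crosses X y → Separates S g y
  Closed⇒Separates closed crosses p = Closed⇒¬Apart closed p crosses

  reaches-end : Connected G S → ∀ g u → Conn G (S - g) u (end₁ G g) ⊎ Conn G (S - g) u (end₂ G g)
  reaches-end connected g u with Conn-split g (connected u (end₁ G g))
  ... | inj₁ p              = inj₁ p
  ... | inj₂ (inj₁ (p , _)) = inj₁ p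
  ... | inj₂ (inj₂ (p , _)) = inj₂ p

  Conn-reroute : S - g ⊆ S′ → Conn G S′ (end₁ G g) (end₂ G g) → Conn G S u v → Conn G S′ u v
  Conn-reroute sub link here = here
  Conn-reroute {g = g} sub link (fwd x x∈S p) with x ≟ g
  ... | yes refl = Conn-trans link (Conn-reroute sub link p)
  ... | no x≢g   = fwd x (sub (x∈p∧x≢y⇒x∈p-y x∈S x≢g)) (Conn-reroute sub link p)
  Conn-reroute {g = g} sub link (bwd x x∈S p) with x ≟ g
  ... | yes refl = Conn-trans (Conn-sym link) (Conn-reroute sub link p)
  ... | no x≢g   = bwd x (sub (x∈p∧x≢y⇒x∈p-y x∈S x≢g)) (Conn-reroute sub link p)

  -- the ends of y reach different ends of g in S - g, so y reconnects them
  swap-Connected : Connected G S → Separates S g y → Connected G (swap S g y)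
  swap-Connected {S} {g} {y} connected separates u v = Conn-reroute S-x⊆swap link (connected u v)
    where
    lift : Conn G (S - g) a b → Conn G (swap S g y) a b
    lift = Conn-mono S-x⊆swap
    link : Conn G (swap S g y) (end₁ G g) (end₂ G g)
    link with reaches-end connected g (end₁ G y) | reaches-end connected g (end₂ G y)
    ... | inj₁ p | inj₁ q = contradiction (Conn-trans p (Conn-sym q)) separates
    ... | inj₂ p | inj₂ q = contradiction (Conn-trans p (Conn-sym q)) separates
    ... | inj₁ p | inj₂ q =
      Conn-trans (lift (Conn-sym p)) (Conn-trans (Conn-edge y∈swap) (lift q))
    ... | inj₂ p | inj₁ q =
      Conn-trans (lift (Conn-sym q)) (Conn-trans (Conn-sym (Conn-edge y∈swap)) (lift p))

  swap-Acyclic : Acyclic G S → Separates S g y → Acyclic G (swap S g y)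
  swap-Acyclic {S} {g} {y} acyclic separates x x∈ p with ∈-swap⁻ x∈
  ... | inj₂ refl        = separates (Conn-mono swap-y⊆S-x p)
  ... | inj₁ (x∈S , x≢g) = avoid-y (Conn-split y p)
    where
    S′⊆S-g : (swap S g y - x) - y ⊆ S - g
    S′⊆S-g z∈ = let z∈′ , z≢y = x∈p-y⇒x∈p×x≢y z∈ in swap-y⊆S-x (x∈p∧x≢y⇒x∈p-y (p─q⊆p _ _ z∈′) z≢y)
    S′⊆S-x : (swap S g y - x) - y ⊆ S - x
    S′⊆S-x z∈ = x∈p∧x≢y⇒x∈p-y (p─q⊆p _ _ (S′⊆S-g z∈)) (proj₂ (x∈p-y⇒x∈p×x≢y (p─q⊆p _ _ z∈)))
    x-edge : Conn G (S - g) (end₁ G x) (end₂ G x)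
    x-edge = Conn-edge (x∈p∧x≢y⇒x∈p-y x∈S x≢g)
    lower : Conn G ((swap S g y - x) - y) a b → Conn G (S - g) a b
    lower = Conn-mono S′⊆S-g
    avoid-y : ¬ (Conn G ((swap S g y - x) - y) (end₁ G x) (end₂ G x)
                 ⊎ Via ((swap S g y - x) - y) y (end₁ G x) (end₂ G x))
    avoid-y (inj₁ q) = acyclic x x∈S (Conn-mono S′⊆S-x q)
    avoid-y (inj₂ (inj₁ (q , r))) =
      separates (Conn-trans (Conn-sym (lower q)) (Conn-trans x-edge (Conn-sym (lower r))))
    avoid-y (inj₂ (inj₂ (q , r))) =
      separates (Conn-trans (lower r) (Conn-trans (Conn-sym x-edge) (lower q)))

  swap-IsBasis : IsBasis G S → Separates S g y → IsBasis G (swap S g y)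
  swap-IsBasis (connected , acyclic) separates =
    swap-Connected connected separates , swap-Acyclic acyclic separates

  bridge-crosses : IsBasis G S → g ∈ S → ∀ u → Crosses (component (S - g) u) g
  bridge-crosses {S} {g} (connected , acyclic) g∈S u with reaches-end connected g u
  ... | inj₁ p = inj₁ (∈-subsetOf⁺ (conn? _ u) p ,
                       λ q → acyclic g g∈S (Conn-trans (Conn-sym p) (∈-subsetOf⁻ (conn? _ u) q)))
  ... | inj₂ p = inj₂ ((λ q → acyclic g g∈S (Conn-trans (Conn-sym (∈-subsetOf⁻ (conn? _ u) q)) p)) ,
                       ∈-subsetOf⁺ (conn? _ u) p)

  Incident : Fin m → Fin n → Set
  Incident g w = end₁ G g ≡ w ⊎ end₂ G g ≡ w

  Incident-≢ : Incident g v → end₁ G x ≢ v → end₂ G x ≢ v → x ≢ g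
  Incident-≢ (inj₁ g₁≡v) x₁≢v _ refl = x₁≢v g₁≡v
  Incident-≢ (inj₂ g₂≡v) _ x₂≢v refl = x₂≢v g₂≡v

  last-bridge : Acyclic G S → Conn G S u v → u ≢ v →
                ∃ λ g → g ∈ S × Incident g v × ¬ Conn G (S - g) u v
  last-bridge acyclic here u≢v = contradiction refl u≢v
  last-bridge {v = v} acyclic (fwd x x∈S p) u≢v with end₂ G x ≟ v
  ... | yes refl = x , x∈S , inj₂ refl , acyclic x x∈S
  ... | no x₂≢v  with last-bridge acyclic p x₂≢v
  ...   | g , g∈S , incident , ¬conn = g , g∈S , incident , λ q →
          ¬conn (Conn-trans (bwd x (x∈p∧x≢y⇒x∈p-y x∈S (Incident-≢ incident u≢v x₂≢v)) here) q)
  last-bridge {v = v} acyclic (bwd x x∈S p) u≢v with end₁ G x ≟ v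
  ... | yes refl = x , x∈S , inj₁ refl , acyclic x x∈S ∘ Conn-sym
  ... | no x₁≢v  with last-bridge acyclic p x₁≢v
  ...   | g , g∈S , incident , ¬conn = g , g∈S , incident , λ q →
          ¬conn (Conn-trans (fwd x (x∈p∧x≢y⇒x∈p-y x∈S (Incident-≢ incident x₁≢v u≢v)) here) q)

  far-end-unique : Connected G S → Incident g v → Incident g v′ →
                   ¬ Conn G (S - g) u v → ¬ Conn G (S - g) u v′ → v ≡ v′
  far-end-unique {g = g} {u = u} connected inc inc′ ¬p ¬p′ with reaches-end connected g u
  ... | inj₁ p = trans (sym (other₂ p inc ¬p)) (other₂ p inc′ ¬p′)
    where
    other₂ : Conn G (S - g) u (end₁ G g) → Incident g w → ¬ Conn G (S - g) u w → end₂ G g ≡ w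
    other₂ p (inj₁ refl) ¬p = contradiction p ¬p
    other₂ p (inj₂ g₂≡w) _  = g₂≡w
  ... | inj₂ p = trans (sym (other₁ p inc ¬p)) (other₁ p inc′ ¬p′)
    where
    other₁ : Conn G (S - g) u (end₂ G g) → Incident g w → ¬ Conn G (S - g) u w → end₁ G g ≡ w
    other₁ p (inj₂ refl) ¬p = contradiction p ¬p
    other₁ p (inj₁ g₁≡w) _  = g₁≡w

  -- were the other element y of B △ B′ in B, then B′ ⊆ B - x would join the ends of x
  Adjacent⇒Exchange : ∀ {B B′ x} → IsBasis G B → IsBasis G B′ → Adjacent G B B′ →
                      x ∈ B → x ∉ B′ → ∃ (Exchange B B′ x)
  Adjacent⇒Exchange {B} {B′} {x} (_ , acyclic) (connected′ , _) adjacent x∈B x∉B′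
    with ∣p∣≡2⇒pair adjacent (∈-△⁺ (inj₁ (x∈B , x∉B′)))
  ... | y , y∈△ , y≢x , cover = y , exchange (∈-△⁻ y∈△)
    where
    outside-△ : ∀ {z} → z ≢ x → z ≢ y → ¬ (z ∈ B × z ∉ B′ ⊎ z ∉ B × z ∈ B′)
    outside-△ z≢x z≢y z∈△ = [ z≢x , z≢y ]′ (cover (∈-△⁺ z∈△))
    B′⊆B : ∀ {z} → z ∈ B′ → z ≢ y → z ∈ B
    B′⊆B {z} z∈B′ z≢y with z ∈? B
    ... | yes z∈B = z∈B
    ... | no z∉B  = contradiction (inj₂ (z∉B , z∈B′)) (outside-△ (x∈p∧y∉p⇒x≢y z∈B′ x∉B′) z≢y)
    exchange : y ∈ B × y ∉ B′ ⊎ y ∉ B × y ∈ B′ → Exchange B B′ x y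
    exchange (inj₁ (y∈B , y∉B′)) = ⊥-elim (acyclic x x∈B (Conn-mono B′⊆B-x (connected′ _ _)))
      where
      B′⊆B-x : B′ ⊆ B - x
      B′⊆B-x z∈B′ = x∈p∧x≢y⇒x∈p-y (B′⊆B z∈B′ (x∈p∧y∉p⇒x≢y z∈B′ y∉B′)) (x∈p∧y∉p⇒x≢y z∈B′ x∉B′)
    exchange (inj₂ (y∉B , y∈B′)) = record
      { x∈B = x∈B ; x∉B′ = x∉B′ ; y∉B = y∉B ; y∈B′ = y∈B′ ; keep = keep ; keep′ = B′⊆B }
      where
      keep : ∀ {z} → z ∈ B → z ≢ x → z ∈ B′
      keep {z} z∈B z≢x with z ∈? B′
      ... | yes z∈B′ = z∈B′
      ... | no z∉B′  = contradiction (inj₁ (z∈B , z∉B′)) (outside-△ z≢x (x∈p∧y∉p⇒x≢y z∈B y∉B))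

-- Good cycles

module _ {n m : ℕ} {G : Graph n m} {e : Fin m} {B₁ B₂ B₃ B₄ : Subset m} where

  Exchanges⇒GoodCycle : ∀ {a b c d x y} → IsBasis G B₃ → IsBasis G B₄ →
                        Exchange B₂ B₃ a b → Exchange B₃ B₄ c d → Exchange B₄ B₁ x y →
                        e ∈ B₁ → e ∉ B₂ → e ∈ B₄ → e ∉ B₃ → GoodCycle G e B₁ B₂ B₃ B₄
  Exchanges⇒GoodCycle B₃-basis B₄-basis ex₂₃ ex₃₄ ex₄₁ e∈B₁ e∉B₂ e∈B₄ e∉B₃ =
    B₃-basis , B₄-basis ,
    x∈p∧x∉q⇒p≢q e∈B₁ e∉B₃ , ≢-sym (Exchange⇒≢ ex₄₁) , Exchange⇒≢ ex₂₃ ,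
    ≢-sym (x∈p∧x∉q⇒p≢q e∈B₄ e∉B₂) , Exchange⇒≢ ex₃₄ ,
    Exchange⇒∣B△B′∣≡2 ex₂₃ , Exchange⇒∣B△B′∣≡2 ex₃₄ , Exchange⇒∣B△B′∣≡2 ex₄₁ ,
    e∈B₄ , e∉B₃

module GoodCycles {n m : ℕ} (G : Graph n m) {B₁ B₂ : Subset m} {e f : Fin m}
                  (B₁-basis : IsBasis G B₁) (B₂-basis : IsBasis G B₂)
                  (exchange : Exchange B₁ B₂ e f) where

  open Exchange exchange
    renaming (x∈B to e∈B₁; x∉B′ to e∉B₂; y∉B to f∉B₁; y∈B′ to f∈B₂; keep to B₁⇒B₂; keep′ to B₂⇒B₁)

  Good : Subset m × Subset m → Set
  Good (B₃ , B₄) = GoodCycle G e B₁ B₂ B₃ B₄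

  GoodRemoving : Fin m → Subset m × Subset m → Set
  GoodRemoving g c = Good c × ∃ (Exchange B₁ (proj₂ c) g)

  module _ {g : Fin m} (g∈B₁ : g ∈ B₁) (g≢e : g ≢ e) where

    private
      g∈B₂ = B₁⇒B₂ g∈B₁ g≢e
      e∈B₄ : ∀ {y} → e ∈ swap B₁ g y
      e∈B₄ = ∈-swap⁺ e∈B₁ (≢-sym g≢e)

    cycle-swapBoth : ∀ {y} → y ∉ B₁ → y ∉ B₂ → Separates G B₁ g y → Separates G B₂ g y →
                     GoodRemoving g (swap B₂ g y , swap B₁ g y)
    cycle-swapBoth y∉B₁ y∉B₂ sep₁ sep₂ =
      Exchanges⇒GoodCycle
        (swap-IsBasis G B₂-basis sep₂) (swap-IsBasis G B₁-basis sep₁)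
        (Exchange-swap g∈B₂ y∉B₂)
        (Exchange-sym (Exchange-swapBoth exchange g∈B₁ g≢e y∉B₁ y∉B₂))
        (Exchange-sym (Exchange-swap g∈B₁ y∉B₁))
        e∈B₁ e∉B₂ e∈B₄ (∉-swap e∉B₂ (x∈p∧y∉p⇒x≢y e∈B₁ y∉B₁)) ,
      _ , Exchange-swap g∈B₁ y∉B₁

    cycle-swapCross : ∀ {y} → y ∉ B₁ → y ∉ B₂ → Separates G B₂ g y → Separates G B₁ g f →
                      GoodRemoving g (swap B₂ g y , swap B₁ g f)
    cycle-swapCross y∉B₁ y∉B₂ sep₂ sep-f =
      Exchanges⇒GoodCycle
        (swap-IsBasis G B₂-basis sep₂) (swap-IsBasis G B₁-basis sep-f)
        (Exchange-swap g∈B₂ y∉B₂)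
        (Exchange-swapCross exchange g∈B₁ g≢e y∉B₁ y∉B₂)
        (Exchange-sym (Exchange-swap g∈B₁ f∉B₁))
        e∈B₁ e∉B₂ e∈B₄ (∉-swap e∉B₂ (x∈p∧y∉p⇒x≢y e∈B₁ y∉B₁)) ,
      _ , Exchange-swap g∈B₁ f∉B₁

    cycle-sameAdded : ∀ {v} → v ∉ B₁ → v ∉ B₂ → Separates G B₁ e v → Separates G B₁ g v →
                      GoodRemoving g (swap B₁ e v , swap B₁ g v)
    cycle-sameAdded v∉B₁ v∉B₂ sep-e sep-g =
      Exchanges⇒GoodCycle
        (swap-IsBasis G B₁-basis sep-e) (swap-IsBasis G B₁-basis sep-g)
        (Exchange-sameRemoved exchange v∉B₁ v∉B₂)
        (swap-sameAdded-Exchange e∈B₁ g∈B₁ g≢e v∉B₁)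
        (Exchange-sym (Exchange-swap g∈B₁ v∉B₁))
        e∈B₁ e∉B₂ e∈B₄ (x∉swap (x∈p∧y∉p⇒x≢y e∈B₁ v∉B₁)) ,
      _ , Exchange-swap g∈B₁ v∉B₁

    module _ {k : ℕ} (3≤k : 3 ≤ k) (edge-connected : EdgeConnected G k) where

      X : Subset n
      X = component G (B₁ - g) (end₁ G g)

      X-closed : Closed G (B₁ - g) X
      X-closed = component-closed G

      g-crosses-X : Crosses G X g
      g-crosses-X = bridge-crosses G B₁-basis g∈B₁ (end₁ G g)

      cycles-f-inside : ¬ Crosses G X f → AtLeast (k ∸ 1) (GoodRemoving g)
      cycles-f-inside f-inside =
        AtLeast-map (λ y → swap B₂ g y , swap B₁ g y) good
                    (λ y∈ _ eq → swap-injective (y∉B₁ y∈) (cong proj₂ eq))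
                    (cut-edges G edge-connected g-crosses-X g)
        where
        X-closed₂ : Closed G (B₂ - g) X
        X-closed₂ {z} z∈ with x∈p-y⇒x∈p×x≢y z∈ | z ≟ f
        ... | _          | yes refl = f-inside
        ... | z∈B₂ , z≢g | no z≢f   = X-closed (x∈p∧x≢y⇒x∈p-y (B₂⇒B₁ z∈B₂ z≢f) z≢g)
        y∉B₁ : ∀ {y} → y ∈ cut G X - g → y ∉ B₁
        y∉B₁ y∈ = uncurry (Closed-minus⇒∉ G X-closed) (∈-cut-y⁻ G y∈)
        good : ∀ {y} → y ∈ cut G X - g → GoodRemoving g (swap B₂ g y , swap B₁ g y)
        good y∈ with ∈-cut-y⁻ G y∈
        ... | crosses , y≢g =
          cycle-swapBoth (y∉B₁ y∈) (Closed-minus⇒∉ G X-closed₂ crosses y≢g)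
                         (Closed⇒Separates G X-closed crosses) (Closed⇒Separates G X-closed₂ crosses)

      module _ (f-crosses : Crosses G X f) where

        Z : Subset n
        Z = component G (B₂ - g) (end₁ G g)

        Z-closed : Closed G (B₂ - g) Z
        Z-closed = component-closed G

        g-crosses-Z : Crosses G Z g
        g-crosses-Z = bridge-crosses G B₂-basis g∈B₂ (end₁ G g)

        cycles-across-Z : AtLeast (k ∸ 1 ∸ 1) (λ c → GoodRemoving g c × proj₂ c ≡ swap B₁ g f)
        cycles-across-Z =
          AtLeast-map (λ y → swap B₂ g y , swap B₁ g f) good
                      (λ y∈ _ eq → swap-injective (y∉B₂ y∈) (cong proj₁ eq))
                      (cut-edges₂ G edge-connected g-crosses-Z g e)
          where
          y∉B₂ : ∀ {y} → y ∈ cut G Z - g - e → y ∉ B₂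
          y∉B₂ y∈ = uncurry (Closed-minus⇒∉ G Z-closed) (∈-cut-y⁻ G (p─q⊆p _ _ y∈))
          good : ∀ {y} → y ∈ cut G Z - g - e →
                 GoodRemoving g (swap B₂ g y , swap B₁ g f) × swap B₁ g f ≡ swap B₁ g f
          good y∈ with x∈p-y⇒x∈p×x≢y y∈
          ... | y∈cut-g , y≢e =
            cycle-swapCross (λ y∈B₁ → y∉B₂ y∈ (B₁⇒B₂ y∈B₁ y≢e)) (y∉B₂ y∈)
                            (Closed⇒Separates G Z-closed (proj₁ (∈-cut-y⁻ G y∈cut-g)))
                            (Closed⇒Separates G X-closed f-crosses) ,
            refl

        module _ {v : Fin m} (v∈ : v ∈ cut G X - g - f) where

          private
            v∈cut-g = proj₁ (x∈p-y⇒x∈p×x≢y v∈)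
            v≢f = proj₂ (x∈p-y⇒x∈p×x≢y v∈)
            v-crosses-X = proj₁ (∈-cut-y⁻ G v∈cut-g)
            v∉B₁ = Closed-minus⇒∉ G X-closed v-crosses-X (proj₂ (∈-cut-y⁻ G v∈cut-g))
            v∉B₂ = λ v∈B₂ → v∉B₁ (B₂⇒B₁ v∈B₂ v≢f)
            g-separates-v = Closed⇒Separates G X-closed v-crosses-X
            B₁-e-g⊆B₁-g : B₁ - e - g ⊆ B₁ - g
            B₁-e-g⊆B₁-g z∈ = let z∈B₁-e , z≢g = x∈p-y⇒x∈p×x≢y z∈
                             in x∈p∧x≢y⇒x∈p-y (p─q⊆p _ _ z∈B₁-e) z≢g
            to-B₂ : ∀ {a b} → Conn G (B₁ - e - g) a b → Conn G (B₂ - g) a b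
            to-B₂ = Conn-mono G λ z∈ → let z∈B₁-e , z≢g = x∈p-y⇒x∈p×x≢y z∈
                                       in x∈p∧x≢y⇒x∈p-y (uncurry B₁⇒B₂ (x∈p-y⇒x∈p×x≢y z∈B₁-e)) z≢g

          -- a walk joining the ends of v in B₁ - e must use g, and then v would cross Z as g does
          e-separates-v : ¬ Crosses G Z v → Separates G B₁ e v
          e-separates-v v-inside-Z p with Conn-split G g p
          ... | inj₁ q = g-separates-v (Conn-mono G B₁-e-g⊆B₁-g q)
          ... | inj₂ (inj₁ (q , r)) =
            v-inside-Z (Apart-resp G Z-closed (Conn-sym G (to-B₂ q)) (to-B₂ r) g-crosses-Z)
          ... | inj₂ (inj₂ (q , r)) =
            v-inside-Z (Apart-resp G Z-closed (Conn-sym G (to-B₂ q)) (to-B₂ r) (Apart-sym G g-crosses-Z))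

          extra-cycle : Dec (Crosses G Z v) → ∃ λ B₃ → GoodRemoving g (B₃ , swap B₁ g v)
          extra-cycle (yes v-crosses-Z) =
            _ , cycle-swapBoth v∉B₁ v∉B₂ g-separates-v (Closed⇒Separates G Z-closed v-crosses-Z)
          extra-cycle (no v-inside-Z) =
            _ , cycle-sameAdded v∉B₁ v∉B₂ (e-separates-v v-inside-Z) g-separates-v

          extra-cycle-distinct : swap B₁ g v ≢ swap B₁ g f
          extra-cycle-distinct = v≢f ∘ swap-injective v∉B₁

        cycles-f-crossing : AtLeast (k ∸ 1) (GoodRemoving g)
        cycles-f-crossing with AtLeast-nonempty (AtLeast-weaken (∸-monoˡ-≤ 1 (∸-monoˡ-≤ 1 3≤k))
                                                (cut-edges₂ G edge-connected g-crosses-X g f))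
        ... | v , v∈ =
          AtLeast-weaken (m≤n+m∸n (k ∸ 1) 1)
            (AtLeast-∷ (proj₂ (extra-cycle v∈ (Crosses? G Z v))) (extra-cycle-distinct v∈)
                       cycles-across-Z)

      cycles-through : AtLeast (k ∸ 1) (GoodRemoving g)
      cycles-through with Crosses? G X f
      ... | yes f-crosses = cycles-f-crossing f-crosses
      ... | no f-inside   = cycles-f-inside f-inside

  module _ {k : ℕ} (3≤k : 3 ≤ k) (edge-connected : EdgeConnected G k) where

    private
      r = end₁ G e
      s = end₂ G e

    FarEnd : Fin n → Fin m → Set
    FarEnd w g = g ∈ B₁ × Incident G g w × ¬ Conn G (B₁ - g) r w

    CycleAt : Fin n → Subset m × Subset m → Set
    CycleAt w c = ∃ λ g → FarEnd w g × GoodRemoving g c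

    CycleAt-unique : ∀ {w w′ c} → CycleAt w c → CycleAt w′ c → w ≡ w′
    CycleAt-unique (_ , (_ , inc , ¬p) , _ , _ , ex) (_ , (_ , inc′ , ¬p′) , _ , _ , ex′)
      with Exchange-removed-unique ex ex′
    ... | refl = far-end-unique G (proj₁ B₁-basis) inc inc′ ¬p ¬p′

    cycles-at : ∀ {w} → w ≢ r × w ≢ s → AtLeast (k ∸ 1) (CycleAt w)
    cycles-at {w} (w≢r , w≢s) with last-bridge G (proj₂ B₁-basis) (proj₁ B₁-basis r w) (≢-sym w≢r)
    ... | g , g∈B₁ , inc , ¬p =
      AtLeast-mono (λ good → g , (g∈B₁ , inc , ¬p) , good)
                   (cycles-through g∈B₁ g≢e 3≤k edge-connected)
      where
      g≢e : g ≢ e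
      g≢e refl = [ w≢r ∘ sym , w≢s ∘ sym ]′ inc

    other-vertices : AtLeast (n ∸ 2) (λ w → w ≢ r × w ≢ s)
    other-vertices =
      AtLeast-mono (λ w∈ → let w∈⊤-r , w≢s = x∈p-y⇒x∈p×x≢y w∈ in proj₂ (x∈p-y⇒x∈p×x≢y w∈⊤-r) , w≢s)
        (AtLeast-subset (⊤ - r - s)
          (subst (_≤ ∣ ⊤ - r - s ∣) (∸-+-assoc n 1 1)
            (c≤∣p∣⇒c∸1≤∣p-x∣ (⊤ - r) s (c≤∣p∣⇒c∸1≤∣p-x∣ ⊤ r (≤-reflexive (sym (∣⊤∣≡n n)))))))

    good-cycles : AtLeast ((n ∸ 2) * (k ∸ 1)) Good
    good-cycles = AtLeast-mono (λ (_ , _ , _ , good , _) → good)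
                               (AtLeast-concat CycleAt-unique cycles-at other-vertices)

lemma2p14 : (k n m : ℕ) → 3 ≤ k → 3 ≤ n → (G : Graph n m) → EdgeConnected G k →
    (B₁ B₂ : Subset m) → IsBasis G B₁ → IsBasis G B₂ → B₁ ≢ B₂ → Adjacent G B₁ B₂ →
    (e : Fin m) → e ∈ B₁ → e ∉ B₂ →
    Σ (List (Subset m × Subset m)) λ cs →
      Unique cs × All (λ c → GoodCycle G e B₁ B₂ (proj₁ c) (proj₂ c)) cs ×
      (n ∸ 2) * (k ∸ 1) ≤ length cs
lemma2p14 k n m 3≤k _ G edge-connected B₁ B₂ B₁-basis B₂-basis _ adjacent e e∈B₁ e∉B₂ =
  elements , unique , valid , enough
  where
  exchange = proj₂ (Adjacent⇒Exchange G B₁-basis B₂-basis adjacent e∈B₁ e∉B₂)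
  open AtLeast (GoodCycles.good-cycles G B₁-basis B₂-basis exchange 3≤k edge-connected)
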